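{- Let $r_1,\dots,r_n\in\mathbb{F}^N$ and let $j_1,\dots,j_k\in[N]$ be distinct. Then $$\mathcal{S}^{\{j_1,\dots,j_k\}}(r_1,\dots,r_n)=\sum_{\tau=(\tau_1,\dots,\tau_k)}\ \prod_{t=1}^k\Big((-1)^{|\tau_t|}\,|\tau_t|!\;r_{\tau_t}(j_t)\Big)\cdot\mathcal{S}\Big(r\big[[n]\setminus\textstyle\bigcup_t\tau_t\big]\Big),$$ where the sum is over all ordered $k$-tuples $(\tau_1,\dots,\tau_k)$ of pairwise disjoint, possibly empty, subsets of $[n]$.
   Context: $\mathbb{F}=\mathbb{F}_p$, $p$ prime. For a matrix $M$ with $s$ rows and $N'$ columns, $\mathcal{S}(M)=\sum_\rho\prod_{i=1}^sM_{i,\rho(i)}$ over injective $\rho:[s]\to[N']$. $\mathcal{S}(r_1,\dots,r_n)$ is $\mathcal{S}$ of the matrix with rows $r_1,\dots,r_n$; for $\sigma\subseteq[n]$, $\mathcal{S}(r[\sigma])$ is $\mathcal{S}$ of the matrix with rows $r_i$, $i\in\sigma$, with $\mathcal{S}(r[\emptyset])=1$. For $T\subseteq[N]$, $\mathcal{S}^T$ is $\mathcal{S}$ applied after deleting the columns in $T$. For $\tau\subseteq[n]$, $r_\tau(j)=\prod_{i\in\tau}r_i(j)$, with $r_\emptyset$ the all-ones vector. -}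

module Defs where

open import Data.Nat as ℕ using (ℕ; zero; suc; _!)
open import Data.Integer as ℤ using (ℤ; +_; _+_; _*_; _-_; 0ℤ; 1ℤ; -1ℤ)
open import Data.Integer.Divisibility using (_∣_)
open import Data.Fin using (Fin; zero; suc)
open import Data.Fin.Properties using (_≟_)
open import Data.Fin.Subset using (Subset; inside; outside; ∣_∣)
open import Data.List using (List; []; _∷_; [_]; map; foldr; length; concatMap; allFin; lookup; filterᵇ)
open import Data.Vec as Vec using (Vec)
open import Data.Bool using (Bool; true; false; _∧_; _∨_; not; if_then_else_)
open import Relation.Nullary.Decidable using (⌊_⌋)

-- Elements of F = F_p are represented by integers; equality in F_p is
-- congruence modulo p.
_≡_[modℤ_] : ℤ → ℤ → ℕ → Set
a ≡ b [modℤ p ] = (+ p) ∣ (a - b)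

ΣL : List ℤ → ℤ
ΣL = foldr _+_ 0ℤ

ΠL : List ℤ → ℤ
ΠL = foldr _*_ 1ℤ

anyFin : {k : ℕ} → (Fin k → Bool) → Bool
anyFin {k} f = foldr _∨_ false (map f (allFin k))

allFinᵇ : {k : ℕ} → (Fin k → Bool) → Bool
allFinᵇ {k} f = foldr _∧_ true (map f (allFin k))

allVecs : {A : Set} → List A → (s : ℕ) → List (Vec A s)
allVecs xs zero = [ Vec.[] ]
allVecs xs (suc s) = concatMap (λ v → map (Vec._∷ v) xs) (allVecs xs s)

_∈ᵇ_ : {n : ℕ} → Fin n → Subset n → Bool
i ∈ᵇ σ with Vec.lookup σ i
... | inside = true
... | outside = false

-- injectivity of a map ρ : [s] → [N'] given as a vector of its values
-- (all values pairwise distinct)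
injectiveᵇ : {s N' : ℕ} → Vec (Fin N') s → Bool
injectiveᵇ Vec.[] = true
injectiveᵇ (x Vec.∷ v) = not (Vec.foldr _ (λ y b → ⌊ x ≟ y ⌋ ∨ b) false v) ∧ injectiveᵇ v

S : {s N' : ℕ} → (Fin s → Fin N' → ℤ) → ℤ
S {s} {N'} M =
  ΣL (map (λ ρ → ΠL (map (λ i → M i (Vec.lookup ρ i)) (allFin s)))
          (filterᵇ injectiveᵇ (allVecs (allFin N') s)))

subMatrix : {n N : ℕ} → (Fin n → Fin N → ℤ) → (rs : List (Fin n)) → (cs : List (Fin N))
          → Fin (length rs) → Fin (length cs) → ℤ
subMatrix r rs cs a b = r (lookup rs a) (lookup cs b)

S^ : {n N : ℕ} → Subset N → (Fin n → Fin N → ℤ) → ℤ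
S^ {n} {N} T r = S (subMatrix r (allFin n) (filterᵇ (λ c → not (c ∈ᵇ T)) (allFin N)))

S[_] : {n N : ℕ} → (Fin n → Fin N → ℤ) → Subset n → ℤ
S[_] {n} {N} r σ = S (subMatrix r (filterᵇ (_∈ᵇ σ) (allFin n)) (allFin N))

rProd : {n N : ℕ} → (Fin n → Fin N → ℤ) → Subset n → Fin N → ℤ
rProd {n} r τ j = ΠL (map (λ i → r i j) (filterᵇ (_∈ᵇ τ) (allFin n)))

imageSet : {k N : ℕ} → (Fin k → Fin N) → Subset N
imageSet j = Vec.tabulate (λ c → if anyFin (λ t → ⌊ j t ≟ c ⌋) then inside else outside)

allSubsets : (n : ℕ) → List (Subset n)
allSubsets n = allVecs (inside ∷ outside ∷ []) n

disjointᵇ : {n : ℕ} → Subset n → Subset n → Bool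
disjointᵇ p q = allFinᵇ (λ i → not (i ∈ᵇ p ∧ i ∈ᵇ q))

pairwiseDisjointᵇ : {n k : ℕ} → Vec (Subset n) k → Bool
pairwiseDisjointᵇ Vec.[] = true
pairwiseDisjointᵇ (p Vec.∷ v) = Vec.foldr _ (λ q b → disjointᵇ p q ∧ b) true v ∧ pairwiseDisjointᵇ v

disjointTuples : (n k : ℕ) → List (Vec (Subset n) k)
disjointTuples n k = filterᵇ pairwiseDisjointᵇ (allVecs (allSubsets n) k)

complementUnion : {n k : ℕ} → Vec (Subset n) k → Subset n
complementUnion τ = Vec.tabulate (λ i → if anyFin (λ t → i ∈ᵇ Vec.lookup τ t) then outside else inside)

RHS : {n N k : ℕ} → (Fin n → Fin N → ℤ) → (Fin k → Fin N) → ℤ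
RHS {n} {N} {k} r j =
  ΣL (map (λ τ → ΠL (map (λ t → (-1ℤ ℤ.^ ∣ Vec.lookup τ t ∣) * (+ (∣ Vec.lookup τ t ∣ !))
                                    * rProd r (Vec.lookup τ t) (j t))
                          (allFin k))
                 * S[ r ] (complementUnion τ))
          (disjointTuples n k))

-- The identity holds exactly over ℤ (S^-expansion), hence modulo every p.
--
-- All quantities are reduced to S-on rows Q, the sum S restricted to a set Q of columns,
-- which satisfies the expansion along the first row (S-subMatrix identifies it with S of a
-- submatrix).  The heart is the one-column case (delete-column): for c ∈ Q,
--   S_{Q∖c}(r[σ]) = Σ_{τ ⊆ σ} (-1)^{|τ|} |τ|! r_τ(c) S_Q(r[σ ∖ τ]).
-- It is proved through Φ(y) = Σ_{τ ⊆ σ} y(y-1)⋯(y-|τ|+1) r_τ(c) S_Q(r[σ ∖ τ]): expanding along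
-- row 0 shows that deleting c from Q raises y by one (Φ-shift), Φ(0) = S_Q(r[σ]) (Φ-zero), and
-- the falling factorial of -1 is (-1)^a a! (sign-factorial).  The k-column formula follows by
-- induction on k (delete-columns): (τ₁, …, τ_k) is pairwise disjoint iff (τ₂, …, τ_k) is and
-- τ₁ ⊆ [n] ∖ ⋃_{t≥2} τ_t, so summing out τ₁ is an instance of the one-column case.

module Submission where

open import Defs
open import Data.Bool using (Bool; true; false; _∧_; _∨_; not; if_then_else_)
open import Data.Empty using (⊥-elim)
open import Data.Fin using (Fin; zero; suc)
open import Data.Fin.Properties using (_≟_; suc-injective)
open import Data.Fin.Subset using (Subset; ∣_∣)
open import Data.Integer as ℤ using (ℤ; +_; _+_; _*_; _-_; 0ℤ; 1ℤ; -1ℤ)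
open import Data.Integer.Properties
  using (+-identityˡ; +-identityʳ; +-assoc; +-inverseʳ; *-zeroʳ; *-identityˡ; *-distribˡ-+; pos-+; pos-*)
open import Data.Integer.Tactic.RingSolver using (solve-∀)
open import Data.List using (List; []; _∷_; map; foldr; allFin; filterᵇ; _++_; concatMap; length; lookup)
open import Data.List.Properties using (map-∘; map-tabulate; map-cong; tabulate-lookup)
import Data.List.Relation.Unary.All as All
open import Data.List.Relation.Unary.AllPairs using (_∷_)
open import Data.List.Membership.Propositional.Properties using (∈-lookup)
open import Data.List.Relation.Unary.Unique.Propositional using (Unique)
open import Data.List.Relation.Unary.Unique.Propositional.Properties using (allFin⁺; filter⁺)
open import Data.Nat as ℕ using (ℕ; zero; suc; _!)
open import Data.Nat.Divisibility using (_∣0)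
open import Data.Nat.Primality using (Prime)
open import Data.Bool.Properties using (T?; ∧-zeroʳ; ∧-identityʳ; ∨-zeroʳ; ∨-identityʳ)
open import Data.Vec as Vec using (Vec)
open import Data.Vec.Properties using (lookup-map; lookup∘tabulate; tabulate∘lookup; tabulate-cong)
open import Function.Definitions using (Injective)
open import Relation.Binary.PropositionalEquality
open import Relation.Nullary using (¬_; yes; no)
open import Relation.Nullary.Decidable using (⌊_⌋)


sumOver : {A : Set} → List A → (A → ℤ) → ℤ
sumOver xs f = ΣL (map f xs)

sumOver-cong : {A : Set} (xs : List A) {f g : A → ℤ} → (∀ x → f x ≡ g x) → sumOver xs f ≡ sumOver xs g
sumOver-cong [] eq = refl
sumOver-cong (x ∷ xs) eq = cong₂ _+_ (eq x) (sumOver-cong xs eq)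

sumOver-++ : {A : Set} (xs ys : List A) (f : A → ℤ) → sumOver (xs ++ ys) f ≡ sumOver xs f + sumOver ys f
sumOver-++ [] ys f = sym (+-identityˡ _)
sumOver-++ (x ∷ xs) ys f = trans (cong (λ z → f x + z) (sumOver-++ xs ys f)) (sym (+-assoc (f x) _ _))

sumOver-+ : {A : Set} (xs : List A) (f g : A → ℤ) → sumOver xs (λ x → f x + g x) ≡ sumOver xs f + sumOver xs g
sumOver-+ [] f g = refl
sumOver-+ (x ∷ xs) f g rewrite sumOver-+ xs f g = interchange (f x) (g x) (sumOver xs f) (sumOver xs g)
  where
  interchange : ∀ a b c d → a + b + (c + d) ≡ a + c + (b + d)
  interchange = solve-∀

sumOver-*ˡ : {A : Set} (xs : List A) (c : ℤ) (f : A → ℤ) → sumOver xs (λ x → c * f x) ≡ c * sumOver xs f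
sumOver-*ˡ [] c f = sym (*-zeroʳ c)
sumOver-*ˡ (x ∷ xs) c f rewrite sumOver-*ˡ xs c f = sym (*-distribˡ-+ c (f x) _)

sumOver-zero : {A : Set} (xs : List A) → sumOver xs (λ _ → 0ℤ) ≡ 0ℤ
sumOver-zero [] = refl
sumOver-zero (x ∷ xs) = trans (+-identityˡ _) (sumOver-zero xs)

sumOver-if : {A : Set} (xs : List A) (b : Bool) (f : A → ℤ) →
  sumOver xs (λ x → if b then f x else 0ℤ) ≡ (if b then sumOver xs f else 0ℤ)
sumOver-if xs true f = refl
sumOver-if xs false f = sumOver-zero xs

sumOver-swap : {A B : Set} (xs : List A) (ys : List B) (f : A → B → ℤ) →
  sumOver xs (λ x → sumOver ys (f x)) ≡ sumOver ys (λ y → sumOver xs (λ x → f x y))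
sumOver-swap [] ys f = sym (sumOver-zero ys)
sumOver-swap (x ∷ xs) ys f =
  trans (cong (λ z → sumOver ys (f x) + z) (sumOver-swap xs ys f)) (sym (sumOver-+ ys (f x) _))

sumOver-map : {A B : Set} (xs : List A) (g : A → B) (f : B → ℤ) → sumOver (map g xs) f ≡ sumOver xs (λ x → f (g x))
sumOver-map xs g f = cong ΣL (sym (map-∘ xs))

sumOver-concatMap : {A B : Set} (xs : List A) (g : A → List B) (f : B → ℤ) →
  sumOver (concatMap g xs) f ≡ sumOver xs (λ x → sumOver (g x) f)
sumOver-concatMap [] g f = refl
sumOver-concatMap (x ∷ xs) g f =
  trans (sumOver-++ (g x) (concatMap g xs) f) (cong (λ z → sumOver (g x) f + z) (sumOver-concatMap xs g f))

sumOver-filter : {A : Set} (xs : List A) (p : A → Bool) (f : A → ℤ) →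
  sumOver (filterᵇ p xs) f ≡ sumOver xs (λ x → if p x then f x else 0ℤ)
sumOver-filter [] p f = refl
sumOver-filter (x ∷ xs) p f with p x
... | true = cong (λ z → f x + z) (sumOver-filter xs p f)
... | false = trans (sumOver-filter xs p f) (sym (+-identityˡ _))

sumOver-allVecs : {A : Set} (xs : List A) (s : ℕ) (F : Vec A (suc s) → ℤ) →
  sumOver (allVecs xs (suc s)) F ≡ sumOver (allVecs xs s) (λ v → sumOver xs (λ x → F (x Vec.∷ v)))
sumOver-allVecs xs s F =
  trans (sumOver-concatMap (allVecs xs s) _ F) (sumOver-cong (allVecs xs s) (λ v → sumOver-map xs _ F))

sumOver-allVecs-map : {A B : Set} (g : A → B) (xs : List A) (s : ℕ) (F : Vec B s → ℤ) →
  sumOver (allVecs (map g xs) s) F ≡ sumOver (allVecs xs s) (λ v → F (Vec.map g v))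
sumOver-allVecs-map g xs zero F = refl
sumOver-allVecs-map g xs (suc s) F =
  trans (sumOver-allVecs (map g xs) s F)
  (trans (sumOver-allVecs-map g xs s _)
  (trans (sumOver-cong (allVecs xs s) (λ v → sumOver-map xs g (λ y → F (y Vec.∷ Vec.map g v))))
  (sym (sumOver-allVecs xs s (λ v → F (Vec.map g v))))))

map-allFin-suc : {A : Set} (n : ℕ) (f : Fin (suc n) → A) → map f (allFin (suc n)) ≡ f zero ∷ map (λ i → f (suc i)) (allFin n)
map-allFin-suc n f = cong (f zero ∷_) (trans (map-tabulate suc f) (sym (map-tabulate (λ i → i) (λ i → f (suc i)))))

sumOver-allFin-suc : (n : ℕ) (f : Fin (suc n) → ℤ) → sumOver (allFin (suc n)) f ≡ f zero + sumOver (allFin n) (λ i → f (suc i))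
sumOver-allFin-suc n f = cong ΣL (map-allFin-suc n f)

productOver-allFin-suc : (n : ℕ) (f : Fin (suc n) → ℤ) → ΠL (map f (allFin (suc n))) ≡ f zero * ΠL (map (λ i → f (suc i)) (allFin n))
productOver-allFin-suc n f = cong ΠL (map-allFin-suc n f)


_without_ : {N : ℕ} → (Fin N → Bool) → Fin N → Fin N → Bool
(Q without d) y = Q y ∧ not ⌊ d ≟ y ⌋

≟-refl : {N : ℕ} (c : Fin N) → ⌊ c ≟ c ⌋ ≡ true
≟-refl c with c ≟ c
... | yes _ = refl
... | no c≢c = ⊥-elim (c≢c refl)

≟-≢ : {N : ℕ} {c d : Fin N} → ¬ c ≡ d → ⌊ c ≟ d ⌋ ≡ false
≟-≢ {c = c} {d} c≢d with c ≟ d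
... | yes c≡d = ⊥-elim (c≢d c≡d)
... | no _ = refl

≟-false⇒≢ : {N : ℕ} {c d : Fin N} → ⌊ c ≟ d ⌋ ≡ false → ¬ c ≡ d
≟-false⇒≢ {c = c} eq refl with trans (sym eq) (≟-refl c)
... | ()

≟-injective : {m N : ℕ} (g : Fin m → Fin N) → Injective _≡_ _≡_ g → ∀ x y → ⌊ g x ≟ g y ⌋ ≡ ⌊ x ≟ y ⌋
≟-injective g g-inj x y with x ≟ y | g x ≟ g y
... | yes _ | yes _ = refl
... | yes x≡y | no gx≢gy = ⊥-elim (gx≢gy (cong g x≡y))
... | no x≢y | yes gx≡gy = ⊥-elim (x≢y (g-inj gx≡gy))
... | no _ | no _ = refl

without-self : {N : ℕ} (Q : Fin N → Bool) (c : Fin N) → (Q without c) c ≡ false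
without-self Q c rewrite ≟-refl c = ∧-zeroʳ (Q c)

without-other : {N : ℕ} (Q : Fin N → Bool) {c d : Fin N} → ¬ c ≡ d → (Q without c) d ≡ Q d
without-other Q {d = d} c≢d rewrite ≟-≢ c≢d = ∧-identityʳ (Q d)

without-comm : {N : ℕ} (Q : Fin N → Bool) (c d x : Fin N) → ((Q without d) without c) x ≡ ((Q without c) without d) x
without-comm Q c d x with Q x | ⌊ c ≟ x ⌋ | ⌊ d ≟ x ⌋
... | false | _ | _ = refl
... | true | true | true = refl
... | true | true | false = refl
... | true | false | true = refl
... | true | false | false = refl

sumOver-delta : (N : ℕ) (c : Fin N) (f : Fin N → ℤ) → sumOver (allFin N) (λ d → if ⌊ c ≟ d ⌋ then f d else 0ℤ) ≡ f c
sumOver-delta (suc N) zero f =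
  trans (sumOver-allFin-suc N (λ d → if ⌊ zero ≟ d ⌋ then f d else 0ℤ))
  (trans (cong (λ z → f zero + z) (sumOver-zero (allFin N))) (+-identityʳ _))
sumOver-delta (suc N) (suc c) f =
  trans (sumOver-allFin-suc N (λ d → if ⌊ suc c ≟ d ⌋ then f d else 0ℤ)) (trans (+-identityˡ _)
  (trans (sumOver-cong (allFin N) (λ d → cong (λ b → if b then f (suc d) else 0ℤ) (≟-injective suc suc-injective c d)))
  (sumOver-delta N c (λ d → f (suc d)))))

sumOver-split : (N : ℕ) (c : Fin N) (f : Fin N → ℤ) →
  sumOver (allFin N) f ≡ f c + sumOver (allFin N) (λ d → if ⌊ c ≟ d ⌋ then 0ℤ else f d)
sumOver-split N c f =
  trans (sumOver-cong (allFin N) split)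
  (trans (sumOver-+ (allFin N) _ _) (cong₂ _+_ (sumOver-delta N c f) refl))
  where
  split : ∀ d → f d ≡ (if ⌊ c ≟ d ⌋ then f d else 0ℤ) + (if ⌊ c ≟ d ⌋ then 0ℤ else f d)
  split d with ⌊ c ≟ d ⌋
  ... | true = sym (+-identityʳ _)
  ... | false = sym (+-identityˡ _)


-- S-on fs Q is S of the matrix with rows fs, using only the columns in Q.
S-on : {N : ℕ} → List (Fin N → ℤ) → (Fin N → Bool) → ℤ
S-on [] Q = 1ℤ
S-on {N} (f ∷ fs) Q = sumOver (allFin N) (λ d → if Q d then f d * S-on fs (Q without d) else 0ℤ)

S-on-cong : {N : ℕ} (fs : List (Fin N → ℤ)) {Q Q′ : Fin N → Bool} → (∀ d → Q d ≡ Q′ d) → S-on fs Q ≡ S-on fs Q′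
S-on-cong [] eq = refl
S-on-cong {N} (f ∷ fs) {Q} {Q′} eq = sumOver-cong (allFin N) term
  where
  term : ∀ d → (if Q d then f d * S-on fs (Q without d) else 0ℤ) ≡ (if Q′ d then f d * S-on fs (Q′ without d) else 0ℤ)
  term d rewrite eq d =
    cong (λ z → if Q′ d then f d * z else 0ℤ) (S-on-cong fs (λ y → cong (λ b → b ∧ not ⌊ d ≟ y ⌋) (eq y)))

S-onList : {N : ℕ} → List (Fin N → ℤ) → List (Fin N) → ℤ
S-onList [] cs = 1ℤ
S-onList (f ∷ fs) cs = sumOver cs (λ d → f d * S-onList fs (filterᵇ (λ y → not ⌊ d ≟ y ⌋) cs))

filter-filter : {A : Set} (p q : A → Bool) (xs : List A) → filterᵇ p (filterᵇ q xs) ≡ filterᵇ (λ y → q y ∧ p y) xs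
filter-filter p q [] = refl
filter-filter p q (x ∷ xs) with q x
... | false = filter-filter p q xs
... | true with p x
...   | true = cong (x ∷_) (filter-filter p q xs)
...   | false = filter-filter p q xs

S-onList-filter : {N : ℕ} (fs : List (Fin N → ℤ)) (Q : Fin N → Bool) → S-onList fs (filterᵇ Q (allFin N)) ≡ S-on fs Q
S-onList-filter [] Q = refl
S-onList-filter {N} (f ∷ fs) Q = trans (sumOver-filter (allFin N) Q _) (sumOver-cong (allFin N) term)
  where
  term : ∀ d → (if Q d then f d * S-onList fs (filterᵇ (λ y → not ⌊ d ≟ y ⌋) (filterᵇ Q (allFin N))) else 0ℤ)
             ≡ (if Q d then f d * S-on fs (Q without d) else 0ℤ)
  term d = cong (λ z → if Q d then f d * z else 0ℤ)
    (trans (cong (S-onList fs) (filter-filter (λ y → not ⌊ d ≟ y ⌋) Q (allFin N))) (S-onList-filter fs (Q without d)))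

occurs : {m s : ℕ} → Fin m → Vec (Fin m) s → Bool
occurs x v = Vec.foldr (λ _ → Bool) (λ y b → ⌊ x ≟ y ⌋ ∨ b) false v

injSum : {s m : ℕ} (M : Fin s → Fin m → ℤ) (xs : List (Fin m)) → ℤ
injSum {s} M xs = sumOver (allVecs xs s) (λ ρ → if injectiveᵇ ρ then ΠL (map (λ i → M i (Vec.lookup ρ i)) (allFin s)) else 0ℤ)

sumOver-avoiding : {m s : ℕ} (xs : List (Fin m)) (x : Fin m) (H : Vec (Fin m) s → ℤ) →
  sumOver (allVecs xs s) (λ v → if not (occurs x v) then H v else 0ℤ) ≡ sumOver (allVecs (filterᵇ (λ y → not ⌊ x ≟ y ⌋) xs) s) H
sumOver-avoiding {s = zero} xs x H = refl
sumOver-avoiding {s = suc s} xs x H =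
  trans (sumOver-allVecs xs s _)
  (trans (sumOver-cong (allVecs xs s) avoid-head)
  (trans (sumOver-avoiding xs x (λ v → sumOver xs (λ y → if not ⌊ x ≟ y ⌋ then H (y Vec.∷ v) else 0ℤ)))
  (trans (sumOver-cong (allVecs xs′ s) (λ v → sym (sumOver-filter xs (λ y → not ⌊ x ≟ y ⌋) (λ y → H (y Vec.∷ v)))))
  (sym (sumOver-allVecs xs′ s H)))))
  where
  xs′ = filterᵇ (λ y → not ⌊ x ≟ y ⌋) xs
  avoid-head : ∀ v → sumOver xs (λ y → if not (⌊ x ≟ y ⌋ ∨ occurs x v) then H (y Vec.∷ v) else 0ℤ)
                   ≡ (if not (occurs x v) then sumOver xs (λ y → if not ⌊ x ≟ y ⌋ then H (y Vec.∷ v) else 0ℤ) else 0ℤ)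
  avoid-head v with occurs x v
  ... | true = trans (sumOver-cong xs (λ y → cong (λ b → if not b then H (y Vec.∷ v) else 0ℤ) (∨-zeroʳ ⌊ x ≟ y ⌋))) (sumOver-zero xs)
  ... | false = sumOver-cong xs (λ y → cong (λ b → if not b then H (y Vec.∷ v) else 0ℤ) (∨-identityʳ ⌊ x ≟ y ⌋))

injSum-expand : {s m : ℕ} (M : Fin s → Fin m → ℤ) (xs : List (Fin m)) → injSum M xs ≡ S-onList (map M (allFin s)) xs
injSum-expand {zero} M xs = +-identityʳ _
injSum-expand {suc s} M xs =
  trans (sumOver-allVecs xs s _)
  (trans (sumOver-cong (allVecs xs s) (λ v → sumOver-cong xs (λ x → first-row x v)))
  (trans (sumOver-swap (allVecs xs s) xs _)
  (trans (sumOver-cong xs (λ x → sumOver-*ˡ (allVecs xs s) (M zero x) _))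
  (trans (sumOver-cong xs (λ x → cong (M zero x *_) (trans (sumOver-avoiding xs x rest) (injSum-expand M′ _))))
  (sym (cong (λ l → S-onList l xs) (map-allFin-suc s M)))))))
  where
  M′ : Fin s → Fin _ → ℤ
  M′ i = M (suc i)
  rest : Vec _ s → ℤ
  rest v = if injectiveᵇ v then ΠL (map (λ i → M′ i (Vec.lookup v i)) (allFin s)) else 0ℤ
  first-row : ∀ x v → (if injectiveᵇ (x Vec.∷ v) then ΠL (map (λ i → M i (Vec.lookup (x Vec.∷ v) i)) (allFin (suc s))) else 0ℤ)
                    ≡ M zero x * (if not (occurs x v) then rest v else 0ℤ)
  first-row x v rewrite productOver-allFin-suc s (λ i → M i (Vec.lookup (x Vec.∷ v) i)) with occurs x v | injectiveᵇ v
  ... | true | _ = sym (*-zeroʳ (M zero x))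
  ... | false | true = refl
  ... | false | false = sym (*-zeroʳ (M zero x))

occurs-map : {m N s : ℕ} (g : Fin m → Fin N) → Injective _≡_ _≡_ g → (x : Fin m) (v : Vec (Fin m) s) →
  occurs (g x) (Vec.map g v) ≡ occurs x v
occurs-map g g-inj x Vec.[] = refl
occurs-map g g-inj x (y Vec.∷ v) = cong₂ _∨_ (≟-injective g g-inj x y) (occurs-map g g-inj x v)

injectiveᵇ-map : {m N s : ℕ} (g : Fin m → Fin N) → Injective _≡_ _≡_ g → (v : Vec (Fin m) s) →
  injectiveᵇ (Vec.map g v) ≡ injectiveᵇ v
injectiveᵇ-map g g-inj Vec.[] = refl
injectiveᵇ-map g g-inj (x Vec.∷ v) = cong₂ (λ a b → not a ∧ b) (occurs-map g g-inj x v) (injectiveᵇ-map g g-inj v)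

injSum-rename : {s m N : ℕ} (M : Fin s → Fin N → ℤ) (g : Fin m → Fin N) → Injective _≡_ _≡_ g → (xs : List (Fin m)) →
  injSum (λ i b → M i (g b)) xs ≡ injSum M (map g xs)
injSum-rename {s} M g g-inj xs = sym (trans (sumOver-allVecs-map g xs s _) (sumOver-cong (allVecs xs s) term))
  where
  term : ∀ ρ → (if injectiveᵇ (Vec.map g ρ) then ΠL (map (λ i → M i (Vec.lookup (Vec.map g ρ) i)) (allFin s)) else 0ℤ)
             ≡ (if injectiveᵇ ρ then ΠL (map (λ i → M i (g (Vec.lookup ρ i))) (allFin s)) else 0ℤ)
  term ρ rewrite injectiveᵇ-map g g-inj ρ =
    cong (λ z → if injectiveᵇ ρ then ΠL z else 0ℤ) (map-cong (λ i → cong (M i) (lookup-map i g ρ)) (allFin s))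

lookup-injective : {A : Set} {xs : List A} → Unique xs → Injective _≡_ _≡_ (lookup xs)
lookup-injective (_ ∷ _) {zero} {zero} eq = refl
lookup-injective (x∉xs ∷ _) {zero} {suc j} eq = ⊥-elim (All.lookup x∉xs (∈-lookup j) eq)
lookup-injective (x∉xs ∷ _) {suc i} {zero} eq = ⊥-elim (All.lookup x∉xs (∈-lookup i) (sym eq))
lookup-injective (_ ∷ u) {suc i} {suc j} eq = cong suc (lookup-injective u eq)

map-lookup-allFin : {A : Set} (xs : List A) → map (lookup xs) (allFin (length xs)) ≡ xs
map-lookup-allFin xs = trans (map-tabulate (λ i → i) (lookup xs)) (tabulate-lookup xs)

S-subMatrix : {n N : ℕ} (r : Fin n → Fin N → ℤ) (rs : List (Fin n)) (Q : Fin N → Bool) →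
  S (subMatrix r rs (filterᵇ Q (allFin N))) ≡ S-on (map r rs) Q
S-subMatrix {n} {N} r rs Q =
  begin
    S (subMatrix r rs cs)
  ≡⟨ sumOver-filter (allVecs (allFin (length cs)) (length rs)) injectiveᵇ _ ⟩
    injSum (λ a b → M a (lookup cs b)) (allFin (length cs))
  ≡⟨ injSum-rename M (lookup cs) (lookup-injective (filter⁺ (λ x → T? (Q x)) (allFin⁺ N))) (allFin (length cs)) ⟩
    injSum M (map (lookup cs) (allFin (length cs)))
  ≡⟨ cong (injSum M) (map-lookup-allFin cs) ⟩
    injSum M cs
  ≡⟨ injSum-expand M cs ⟩
    S-onList (map M (allFin (length rs))) cs
  ≡⟨ cong (λ l → S-onList l cs) (trans (map-∘ (allFin (length rs))) (cong (map r) (map-lookup-allFin rs))) ⟩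
    S-onList (map r rs) cs
  ≡⟨ S-onList-filter (map r rs) Q ⟩
    S-on (map r rs) Q
  ∎
  where
  open ≡-Reasoning
  cs = filterᵇ Q (allFin N)
  M : Fin (length rs) → Fin N → ℤ
  M a c = r (lookup rs a) c


∈ᵇ-lookup : {n : ℕ} (i : Fin n) (σ : Subset n) → (i ∈ᵇ σ) ≡ Vec.lookup σ i
∈ᵇ-lookup i σ with Vec.lookup σ i
... | true = refl
... | false = refl

∈ᵇ-suc : {n : ℕ} (i : Fin n) (b : Bool) (σ : Subset n) → (suc i ∈ᵇ (b Vec.∷ σ)) ≡ (i ∈ᵇ σ)
∈ᵇ-suc i b σ = trans (∈ᵇ-lookup (suc i) (b Vec.∷ σ)) (sym (∈ᵇ-lookup i σ))

subset-ext : {n : ℕ} {σ σ′ : Subset n} → (∀ i → Vec.lookup σ i ≡ Vec.lookup σ′ i) → σ ≡ σ′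
subset-ext {σ = σ} {σ′} eq = trans (sym (tabulate∘lookup σ)) (trans (tabulate-cong eq) (tabulate∘lookup σ′))

members : {n : ℕ} → Subset n → List (Fin n)
members {n} σ = filterᵇ (_∈ᵇ σ) (allFin n)

rowsOf : {n N : ℕ} → (Fin n → Fin N → ℤ) → Subset n → List (Fin N → ℤ)
rowsOf r σ = map r (members σ)

filter-map : {A B : Set} (p : B → Bool) (g : A → B) (xs : List A) → filterᵇ p (map g xs) ≡ map g (filterᵇ (λ x → p (g x)) xs)
filter-map p g [] = refl
filter-map p g (x ∷ xs) with p (g x)
... | true = cong (g x ∷_) (filter-map p g xs)
... | false = filter-map p g xs

filter-cong : {A : Set} {p q : A → Bool} → (∀ x → p x ≡ q x) → (xs : List A) → filterᵇ p xs ≡ filterᵇ q xs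
filter-cong eq [] = refl
filter-cong {p = p} {q} eq (x ∷ xs) with p x | q x | eq x
... | true | true | refl = cong (x ∷_) (filter-cong eq xs)
... | false | false | refl = filter-cong eq xs

filter-true : {A : Set} (xs : List A) → filterᵇ (λ _ → true) xs ≡ xs
filter-true [] = refl
filter-true (x ∷ xs) = cong (x ∷_) (filter-true xs)

members-tail : {n : ℕ} (b : Bool) (σ : Subset n) → filterᵇ (_∈ᵇ (b Vec.∷ σ)) (map suc (allFin n)) ≡ map suc (members σ)
members-tail {n} b σ =
  trans (filter-map (_∈ᵇ (b Vec.∷ σ)) suc (allFin n)) (cong (map suc) (filter-cong (λ i → ∈ᵇ-suc i b σ) (allFin n)))

allFin-suc : (n : ℕ) → allFin (suc n) ≡ zero ∷ map suc (allFin n)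
allFin-suc n = cong (zero ∷_) (sym (map-tabulate (λ i → i) suc))

members-inside : {n : ℕ} (σ : Subset n) → members (true Vec.∷ σ) ≡ zero ∷ map suc (members σ)
members-inside {n} σ = trans (cong (filterᵇ (_∈ᵇ (true Vec.∷ σ))) (allFin-suc n)) (cong (zero ∷_) (members-tail true σ))

members-outside : {n : ℕ} (σ : Subset n) → members (false Vec.∷ σ) ≡ map suc (members σ)
members-outside {n} σ = trans (cong (filterᵇ (_∈ᵇ (false Vec.∷ σ))) (allFin-suc n)) (members-tail false σ)

map-members-inside : {n : ℕ} {A : Set} (h : Fin (suc n) → A) (σ : Subset n) →
  map h (members (true Vec.∷ σ)) ≡ h zero ∷ map (λ i → h (suc i)) (members σ)
map-members-inside h σ = trans (cong (map h) (members-inside σ)) (cong (h zero ∷_) (sym (map-∘ (members σ))))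

map-members-outside : {n : ℕ} {A : Set} (h : Fin (suc n) → A) (σ : Subset n) →
  map h (members (false Vec.∷ σ)) ≡ map (λ i → h (suc i)) (members σ)
map-members-outside h σ = trans (cong (map h) (members-outside σ)) (sym (map-∘ (members σ)))

members-all : (n : ℕ) → members (Vec.tabulate {n = n} (λ _ → true)) ≡ allFin n
members-all n =
  trans (filter-cong (λ i → trans (∈ᵇ-lookup i (Vec.tabulate (λ _ → true))) (lookup∘tabulate (λ _ → true) i)) (allFin n))
  (filter-true (allFin n))

-- Set difference σ ∖ τ, by recursion on the vectors so that it computes on cons cells.
_∖_ : {n : ℕ} → Subset n → Subset n → Subset n
Vec.[] ∖ Vec.[] = Vec.[]
(x Vec.∷ σ) ∖ (true Vec.∷ τ) = false Vec.∷ (σ ∖ τ)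
(x Vec.∷ σ) ∖ (false Vec.∷ τ) = x Vec.∷ (σ ∖ τ)

_⊆ᵇ_ : {n : ℕ} → Subset n → Subset n → Bool
Vec.[] ⊆ᵇ Vec.[] = true
(true Vec.∷ τ) ⊆ᵇ (true Vec.∷ σ) = τ ⊆ᵇ σ
(true Vec.∷ τ) ⊆ᵇ (false Vec.∷ σ) = false
(false Vec.∷ τ) ⊆ᵇ (_ Vec.∷ σ) = τ ⊆ᵇ σ

module _ {n N : ℕ} (r : Fin (suc n) → Fin N → ℤ) where

  tailRows : Fin n → Fin N → ℤ
  tailRows i = r (suc i)

  rProd-inside : (τ : Subset n) (c : Fin N) → rProd r (true Vec.∷ τ) c ≡ r zero c * rProd tailRows τ c
  rProd-inside τ c = cong ΠL (map-members-inside (λ i → r i c) τ)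

  rProd-outside : (τ : Subset n) (c : Fin N) → rProd r (false Vec.∷ τ) c ≡ rProd tailRows τ c
  rProd-outside τ c = cong ΠL (map-members-outside (λ i → r i c) τ)

  rowsOf-inside : (σ : Subset n) → rowsOf r (true Vec.∷ σ) ≡ r zero ∷ rowsOf tailRows σ
  rowsOf-inside σ = map-members-inside r σ

  rowsOf-outside : (σ : Subset n) → rowsOf r (false Vec.∷ σ) ≡ rowsOf tailRows σ
  rowsOf-outside σ = map-members-outside r σ


falling : ℤ → ℕ → ℤ
falling y zero = 1ℤ
falling y (suc a) = y * falling (y - 1ℤ) a

-- At y = 0 only τ = ∅ contributes (Φ-zero), and removing the column c from Q is
-- compensated by raising y by one (Φ-shift); at y = -1 this is the one-column formula.
ΦTerm : {n N : ℕ} → (Fin n → Fin N → ℤ) → Subset n → (Fin N → Bool) → Fin N → ℤ → Subset n → ℤ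
ΦTerm r σ Q c y τ = if τ ⊆ᵇ σ then falling y ∣ τ ∣ * rProd r τ c * S-on (rowsOf r (σ ∖ τ)) Q else 0ℤ

Φ : {n N : ℕ} → (Fin n → Fin N → ℤ) → Subset n → (Fin N → Bool) → Fin N → ℤ → ℤ
Φ {n} r σ Q c y = sumOver (allSubsets n) (ΦTerm r σ Q c y)

Φ-cong : {n N : ℕ} (r : Fin n → Fin N → ℤ) (σ : Subset n) {Q Q′ : Fin N → Bool} (c : Fin N) (y : ℤ) →
  (∀ d → Q d ≡ Q′ d) → Φ r σ Q c y ≡ Φ r σ Q′ c y
Φ-cong {n} r σ c y eq = sumOver-cong (allSubsets n)
  (λ τ → cong (λ z → if τ ⊆ᵇ σ then falling y ∣ τ ∣ * rProd r τ c * z else 0ℤ) (S-on-cong (rowsOf r (σ ∖ τ)) eq))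

sumOver-allSubsets-suc : (n : ℕ) (F : Subset (suc n) → ℤ) →
  sumOver (allSubsets (suc n)) F ≡ sumOver (allSubsets n) (λ τ → F (true Vec.∷ τ)) + sumOver (allSubsets n) (λ τ → F (false Vec.∷ τ))
sumOver-allSubsets-suc n F =
  trans (sumOver-allVecs (true ∷ false ∷ []) n F)
  (trans (sumOver-cong (allSubsets n) (λ τ → cong (λ z → F (true Vec.∷ τ) + z) (+-identityʳ _)))
  (sumOver-+ (allSubsets n) _ _))

Φ-outside : {n N : ℕ} (r : Fin (suc n) → Fin N → ℤ) (σ : Subset n) (Q : Fin N → Bool) (c : Fin N) (y : ℤ) →
  Φ r (false Vec.∷ σ) Q c y ≡ Φ (tailRows r) σ Q c y
Φ-outside {n} r σ Q c y =
  begin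
    Φ r (false Vec.∷ σ) Q c y
  ≡⟨ sumOver-allSubsets-suc n (ΦTerm r (false Vec.∷ σ) Q c y) ⟩
    sumOver (allSubsets n) (λ _ → 0ℤ) + sumOver (allSubsets n) (λ τ → ΦTerm r (false Vec.∷ σ) Q c y (false Vec.∷ τ))
  ≡⟨ cong₂ _+_ (sumOver-zero (allSubsets n)) (sumOver-cong (allSubsets n) term) ⟩
    0ℤ + Φ (tailRows r) σ Q c y
  ≡⟨ +-identityˡ _ ⟩
    Φ (tailRows r) σ Q c y
  ∎
  where
  open ≡-Reasoning
  term : ∀ τ → ΦTerm r (false Vec.∷ σ) Q c y (false Vec.∷ τ) ≡ ΦTerm (tailRows r) σ Q c y τ
  term τ = cong₂ (λ a rows → if τ ⊆ᵇ σ then falling y ∣ τ ∣ * a * S-on rows Q else 0ℤ)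
                 (rProd-outside r τ c) (rowsOf-outside r (σ ∖ τ))

module _ {n N : ℕ} (r : Fin (suc n) → Fin N → ℤ) (σ : Subset n) (c : Fin N) where

  -- The terms with 0 ∈ τ: row 0 is matched with the column c.
  ΦTerm-with-row0 : (Q : Fin N → Bool) (y : ℤ) (τ : Subset n) →
    ΦTerm r (true Vec.∷ σ) Q c y (true Vec.∷ τ) ≡ y * r zero c * ΦTerm (tailRows r) σ Q c (y - 1ℤ) τ
  ΦTerm-with-row0 Q y τ =
    trans (cong₂ (λ a rows → if τ ⊆ᵇ σ then y * F * a * S-on rows Q else 0ℤ) (rProd-inside r τ c) (rowsOf-outside r (σ ∖ τ)))
          (regroup (τ ⊆ᵇ σ))
    where
    F = falling (y - 1ℤ) ∣ τ ∣
    p = rProd (tailRows r) τ c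
    s = S-on (rowsOf (tailRows r) (σ ∖ τ)) Q
    regroup : (b : Bool) → (if b then y * F * (r zero c * p) * s else 0ℤ) ≡ y * r zero c * (if b then F * p * s else 0ℤ)
    regroup true = ring y F (r zero c) p s
      where
      ring : ∀ y f a p s → y * f * (a * p) * s ≡ y * a * (f * p * s)
      ring = solve-∀
    regroup false = sym (*-zeroʳ (y * r zero c))

  -- The terms with 0 ∉ τ: row 0 stays in σ ∖ τ and S_Q is expanded along it.
  ΦTerm-without-row0 : (Q : Fin N → Bool) (y : ℤ) (τ : Subset n) →
    ΦTerm r (true Vec.∷ σ) Q c y (false Vec.∷ τ)
      ≡ sumOver (allFin N) (λ d → if Q d then r zero d * ΦTerm (tailRows r) σ (Q without d) c y τ else 0ℤ)
  ΦTerm-without-row0 Q y τ =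
    trans (cong₂ (λ a rows → if τ ⊆ᵇ σ then F * a * S-on rows Q else 0ℤ) (rProd-outside r τ c) (rowsOf-inside r (σ ∖ τ)))
          (expand (τ ⊆ᵇ σ))
    where
    F = falling y ∣ τ ∣
    K = F * rProd (tailRows r) τ c
    P : Fin N → ℤ
    P d = S-on (rowsOf (tailRows r) (σ ∖ τ)) (Q without d)
    term : ∀ d → K * (if Q d then r zero d * P d else 0ℤ) ≡ (if Q d then r zero d * (K * P d) else 0ℤ)
    term d with Q d
    ... | false = *-zeroʳ K
    ... | true = swap K (r zero d) (P d)
      where
      swap : ∀ k a p → k * (a * p) ≡ a * (k * p)
      swap = solve-∀
    expand : (b : Bool) → (if b then K * sumOver (allFin N) (λ d → if Q d then r zero d * P d else 0ℤ) else 0ℤ)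
                        ≡ sumOver (allFin N) (λ d → if Q d then r zero d * (if b then K * P d else 0ℤ) else 0ℤ)
    expand true = trans (sym (sumOver-*ˡ (allFin N) K (λ d → if Q d then r zero d * P d else 0ℤ))) (sumOver-cong (allFin N) term)
    expand false = sym (trans (sumOver-cong (allFin N) vanish) (sumOver-zero (allFin N)))
      where
      vanish : ∀ d → (if Q d then r zero d * 0ℤ else 0ℤ) ≡ 0ℤ
      vanish d with Q d
      ... | true = *-zeroʳ (r zero d)
      ... | false = refl

  Φ-inside : (Q : Fin N → Bool) (y : ℤ) →
    Φ r (true Vec.∷ σ) Q c y
      ≡ y * r zero c * Φ (tailRows r) σ Q c (y - 1ℤ)
        + sumOver (allFin N) (λ d → if Q d then r zero d * Φ (tailRows r) σ (Q without d) c y else 0ℤ)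
  Φ-inside Q y =
    begin
      Φ r (true Vec.∷ σ) Q c y
    ≡⟨ sumOver-allSubsets-suc n _ ⟩
      sumOver (allSubsets n) (λ τ → ΦTerm r (true Vec.∷ σ) Q c y (true Vec.∷ τ))
        + sumOver (allSubsets n) (λ τ → ΦTerm r (true Vec.∷ σ) Q c y (false Vec.∷ τ))
    ≡⟨ cong₂ _+_ (sumOver-cong (allSubsets n) (ΦTerm-with-row0 Q y)) (sumOver-cong (allSubsets n) (ΦTerm-without-row0 Q y)) ⟩
      sumOver (allSubsets n) (λ τ → y * r zero c * ΦTerm (tailRows r) σ Q c (y - 1ℤ) τ)
        + sumOver (allSubsets n) (λ τ → sumOver (allFin N) (λ d → if Q d then r zero d * ΦTerm (tailRows r) σ (Q without d) c y τ else 0ℤ))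
    ≡⟨ cong₂ _+_ (sumOver-*ˡ (allSubsets n) (y * r zero c) (ΦTerm (tailRows r) σ Q c (y - 1ℤ))) (trans (sumOver-swap (allSubsets n) (allFin N) _) (sumOver-cong (allFin N) pull-out)) ⟩
      y * r zero c * Φ (tailRows r) σ Q c (y - 1ℤ)
        + sumOver (allFin N) (λ d → if Q d then r zero d * Φ (tailRows r) σ (Q without d) c y else 0ℤ)
    ∎
    where
    open ≡-Reasoning
    pull-out : ∀ d → sumOver (allSubsets n) (λ τ → if Q d then r zero d * ΦTerm (tailRows r) σ (Q without d) c y τ else 0ℤ)
                   ≡ (if Q d then r zero d * Φ (tailRows r) σ (Q without d) c y else 0ℤ)
    pull-out d =
      trans (sumOver-if (allSubsets n) (Q d) (λ τ → r zero d * ΦTerm (tailRows r) σ (Q without d) c y τ))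
      (cong (λ z → if Q d then z else 0ℤ) (sumOver-*ˡ (allSubsets n) (r zero d) (ΦTerm (tailRows r) σ (Q without d) c y)))

-- At y = 0 every τ ≠ ∅ carries the factor falling 0 |τ| = 0.
Φ-zero : {n N : ℕ} (r : Fin n → Fin N → ℤ) (σ : Subset n) (Q : Fin N → Bool) (c : Fin N) →
  Φ r σ Q c 0ℤ ≡ S-on (rowsOf r σ) Q
Φ-zero r Vec.[] Q c = refl
Φ-zero r (false Vec.∷ σ) Q c =
  trans (Φ-outside r σ Q c 0ℤ) (trans (Φ-zero (tailRows r) σ Q c) (sym (cong (λ rows → S-on rows Q) (rowsOf-outside r σ))))
Φ-zero {N = N} r (true Vec.∷ σ) Q c =
  begin
    Φ r (true Vec.∷ σ) Q c 0ℤ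
  ≡⟨ Φ-inside r σ c Q 0ℤ ⟩
    0ℤ + sumOver (allFin N) (λ d → if Q d then r zero d * Φ (tailRows r) σ (Q without d) c 0ℤ else 0ℤ)
  ≡⟨ +-identityˡ _ ⟩
    sumOver (allFin N) (λ d → if Q d then r zero d * Φ (tailRows r) σ (Q without d) c 0ℤ else 0ℤ)
  ≡⟨ sumOver-cong (allFin N) (λ d → cong (λ z → if Q d then r zero d * z else 0ℤ) (Φ-zero (tailRows r) σ (Q without d) c)) ⟩
    S-on (r zero ∷ rowsOf (tailRows r) σ) Q
  ≡⟨ cong (λ rows → S-on rows Q) (rowsOf-inside r σ) ⟨
    S-on (rowsOf r (true Vec.∷ σ)) Q
  ∎
  where open ≡-Reasoning

indicator : Bool → ℤ
indicator b = if b then 1ℤ else 0ℤ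

-- The contribution of the column c itself in the proof of Φ-shift: when c ∈ Q, the term
-- of row 0 at column c turns y into y + 1.
shift-column : (b : Bool) (Z : ℤ → ℤ) (a y : ℤ) →
  y * a * Z (y - 1ℤ + indicator b) + (if b then a * Z y else 0ℤ) ≡ (y + indicator b) * a * Z (y + indicator b - 1ℤ)
shift-column true Z a y =
  trans (cong (λ t → y * a * Z t + a * Z y) (cancel₁ y))
  (trans (ring a y (Z y)) (cong (λ t → (y + 1ℤ) * a * Z t) (sym (cancel₂ y))))
  where
  cancel₁ : ∀ y → y - 1ℤ + 1ℤ ≡ y
  cancel₁ = solve-∀
  cancel₂ : ∀ y → y + 1ℤ - 1ℤ ≡ y
  cancel₂ = solve-∀
  ring : ∀ a y z → y * a * z + a * z ≡ (y + 1ℤ) * a * z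
  ring = solve-∀
shift-column false Z a y rewrite +-identityʳ (y - 1ℤ) | +-identityʳ y = +-identityʳ _

else-cong : (b : Bool) {x x′ : ℤ} → (b ≡ false → x ≡ x′) → (if b then 0ℤ else x) ≡ (if b then 0ℤ else x′)
else-cong true eq = refl
else-cong false eq = eq refl

Φ-shift : {n N : ℕ} (r : Fin n → Fin N → ℤ) (σ : Subset n) (Q : Fin N → Bool) (c : Fin N) (y : ℤ) →
  Φ r σ Q c y ≡ Φ r σ (Q without c) c (y + indicator (Q c))
Φ-shift r Vec.[] Q c y = refl
Φ-shift r (false Vec.∷ σ) Q c y =
  trans (Φ-outside r σ Q c y) (trans (Φ-shift (tailRows r) σ Q c y) (sym (Φ-outside r σ (Q without c) c _)))
Φ-shift {N = N} r (true Vec.∷ σ) Q c y =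
  begin
    Φ r (true Vec.∷ σ) Q c y
  ≡⟨ Φ-inside r σ c Q y ⟩
    y * a * Φ (tailRows r) σ Q c (y - 1ℤ) + sumOver (allFin N) F
  ≡⟨ cong₂ _+_ (cong (y * a *_) (Φ-shift (tailRows r) σ Q c (y - 1ℤ))) (sumOver-split N c F) ⟩
    y * a * Z (y - 1ℤ + indicator (Q c)) + (F c + sumOver (allFin N) (away F))
  ≡⟨ +-assoc (y * a * Z (y - 1ℤ + indicator (Q c))) (F c) (sumOver (allFin N) (away F)) ⟨
    (y * a * Z (y - 1ℤ + indicator (Q c)) + F c) + sumOver (allFin N) (away F)
  ≡⟨ cong₂ _+_ (shift-column (Q c) Z a y) (sumOver-cong (allFin N) away-from-c) ⟩
    y′ * a * Z (y′ - 1ℤ) + sumOver (allFin N) (away G)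
  ≡⟨ cong (λ z → y′ * a * Z (y′ - 1ℤ) + z) (trans (sym (+-identityˡ _)) (cong (_+ sumOver (allFin N) (away G)) (sym G-at-c))) ⟩
    y′ * a * Z (y′ - 1ℤ) + (G c + sumOver (allFin N) (away G))
  ≡⟨ cong (λ z → y′ * a * Z (y′ - 1ℤ) + z) (sumOver-split N c G) ⟨
    y′ * a * Z (y′ - 1ℤ) + sumOver (allFin N) G
  ≡⟨ Φ-inside r σ c (Q without c) y′ ⟨
    Φ r (true Vec.∷ σ) (Q without c) c y′
  ∎
  where
  open ≡-Reasoning
  a = r zero c
  y′ = y + indicator (Q c)
  Z : ℤ → ℤ
  Z t = Φ (tailRows r) σ (Q without c) c t
  F G : Fin N → ℤ
  F d = if Q d then r zero d * Φ (tailRows r) σ (Q without d) c y else 0ℤ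
  G d = if (Q without c) d then r zero d * Φ (tailRows r) σ ((Q without c) without d) c y′ else 0ℤ
  away : (Fin N → ℤ) → Fin N → ℤ
  away f d = if ⌊ c ≟ d ⌋ then 0ℤ else f d
  G-at-c : G c ≡ 0ℤ
  G-at-c rewrite without-self Q c = refl
  -- For d ≠ c, the induction hypothesis applied to Q ∖ {d} matches the two terms.
  F≡G : ∀ d → ¬ c ≡ d → F d ≡ G d
  F≡G d c≢d rewrite without-other Q c≢d =
    cong (λ z → if Q d then r zero d * z else 0ℤ)
    (trans (Φ-shift (tailRows r) σ (Q without d) c y)
    (trans (Φ-cong (tailRows r) σ c _ (without-comm Q c d))
    (cong (λ b → Φ (tailRows r) σ ((Q without c) without d) c (y + indicator b)) (without-other Q (λ d≡c → c≢d (sym d≡c))))))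
  away-from-c : ∀ d → away F d ≡ away G d
  away-from-c d = else-cong ⌊ c ≟ d ⌋ (λ eq → F≡G d (≟-false⇒≢ eq))

falling-suc : ∀ y a → falling y (suc a) ≡ falling y a * (y - + a)
falling-suc y zero = ring y
  where
  ring : ∀ y → y * 1ℤ ≡ 1ℤ * (y - 0ℤ)
  ring = solve-∀
falling-suc y (suc a) =
  trans (cong (y *_) (falling-suc (y - 1ℤ) a))
  (trans (ring y (falling (y - 1ℤ) a) (+ a)) (cong (λ z → y * falling (y - 1ℤ) a * (y - z)) (sym (pos-+ 1 a))))
  where
  ring : ∀ y F A → y * (F * (y - 1ℤ - A)) ≡ y * F * (y - (1ℤ + A))
  ring = solve-∀

sign-factorial : ∀ a → (-1ℤ ℤ.^ a) * (+ (a !)) ≡ falling -1ℤ a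
sign-factorial zero = refl
sign-factorial (suc a) =
  trans (cong (λ z → -1ℤ * (-1ℤ ℤ.^ a) * z) (trans (pos-* (suc a) (a !)) (cong (_* + (a !)) (pos-+ 1 a))))
  (trans (ring (-1ℤ ℤ.^ a) (+ (a !)) (+ a))
  (trans (cong (_* (-1ℤ - + a)) (sign-factorial a)) (sym (falling-suc -1ℤ a))))
  where
  ring : ∀ P F A → -1ℤ * P * ((1ℤ + A) * F) ≡ P * F * (-1ℤ - A)
  ring = solve-∀

weight : {n N : ℕ} → (Fin n → Fin N → ℤ) → Subset n → Fin N → ℤ
weight r τ c = (-1ℤ ℤ.^ ∣ τ ∣) * (+ (∣ τ ∣ !)) * rProd r τ c

delete-column : {n N : ℕ} (r : Fin n → Fin N → ℤ) (σ : Subset n) (Q : Fin N → Bool) (c : Fin N) → Q c ≡ true →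
  sumOver (allSubsets n) (λ τ → if τ ⊆ᵇ σ then weight r τ c * S-on (rowsOf r (σ ∖ τ)) Q else 0ℤ)
    ≡ S-on (rowsOf r σ) (Q without c)
delete-column {n} r σ Q c c∈Q =
  begin
    sumOver (allSubsets n) (λ τ → if τ ⊆ᵇ σ then weight r τ c * S-on (rowsOf r (σ ∖ τ)) Q else 0ℤ)
  ≡⟨ sumOver-cong (allSubsets n) (λ τ → cong (λ w → if τ ⊆ᵇ σ then w * rProd r τ c * S-on (rowsOf r (σ ∖ τ)) Q else 0ℤ)
                                               (sign-factorial ∣ τ ∣)) ⟩
    Φ r σ Q c -1ℤ
  ≡⟨ Φ-shift r σ Q c -1ℤ ⟩
    Φ r σ (Q without c) c (-1ℤ + indicator (Q c))
  ≡⟨ cong (λ b → Φ r σ (Q without c) c (-1ℤ + indicator b)) c∈Q ⟩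
    Φ r σ (Q without c) c 0ℤ
  ≡⟨ Φ-zero r σ (Q without c) c ⟩
    S-on (rowsOf r σ) (Q without c)
  ∎
  where open ≡-Reasoning


anyFin-suc : {k : ℕ} (f : Fin (suc k) → Bool) → anyFin f ≡ (f zero ∨ anyFin (λ t → f (suc t)))
anyFin-suc {k} f = cong (foldr _∨_ false) (map-allFin-suc k f)

allFinᵇ-suc : {k : ℕ} (f : Fin (suc k) → Bool) → allFinᵇ f ≡ (f zero ∧ allFinᵇ (λ t → f (suc t)))
allFinᵇ-suc {k} f = cong (foldr _∧_ true) (map-allFin-suc k f)

lookup-∖ : {n : ℕ} (σ τ : Subset n) (i : Fin n) → Vec.lookup (σ ∖ τ) i ≡ (Vec.lookup σ i ∧ not (Vec.lookup τ i))
lookup-∖ (x Vec.∷ σ) (true Vec.∷ τ) zero = sym (∧-zeroʳ x)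
lookup-∖ (x Vec.∷ σ) (false Vec.∷ τ) zero = sym (∧-identityʳ x)
lookup-∖ (x Vec.∷ σ) (true Vec.∷ τ) (suc i) = lookup-∖ σ τ i
lookup-∖ (x Vec.∷ σ) (false Vec.∷ τ) (suc i) = lookup-∖ σ τ i

lookup-complementUnion : {n k : ℕ} (τ : Vec (Subset n) k) (i : Fin n) →
  Vec.lookup (complementUnion τ) i ≡ not (anyFin (λ t → i ∈ᵇ Vec.lookup τ t))
lookup-complementUnion τ i = trans (lookup∘tabulate _ i) (if-false-true (anyFin (λ t → i ∈ᵇ Vec.lookup τ t)))
  where
  if-false-true : (b : Bool) → (if b then false else true) ≡ not b
  if-false-true true = refl
  if-false-true false = refl

complementUnion-cons : {n k : ℕ} (τ₁ : Subset n) (τ : Vec (Subset n) k) →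
  complementUnion (τ₁ Vec.∷ τ) ≡ complementUnion τ ∖ τ₁
complementUnion-cons τ₁ τ = subset-ext pointwise
  where
  pointwise : ∀ i → Vec.lookup (complementUnion (τ₁ Vec.∷ τ)) i ≡ Vec.lookup (complementUnion τ ∖ τ₁) i
  pointwise i
    rewrite lookup-complementUnion (τ₁ Vec.∷ τ) i | anyFin-suc (λ t → i ∈ᵇ Vec.lookup (τ₁ Vec.∷ τ) t)
          | lookup-∖ (complementUnion τ) τ₁ i | lookup-complementUnion τ i | ∈ᵇ-lookup i τ₁
    with Vec.lookup τ₁ i
  ... | true = sym (∧-zeroʳ _)
  ... | false = sym (∧-identityʳ _)

⊆ᵇ-full : {n : ℕ} (τ : Subset n) → τ ⊆ᵇ Vec.tabulate (λ _ → true) ≡ true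
⊆ᵇ-full Vec.[] = refl
⊆ᵇ-full (true Vec.∷ τ) = ⊆ᵇ-full τ
⊆ᵇ-full (false Vec.∷ τ) = ⊆ᵇ-full τ

disjointᵇ-cons : {n : ℕ} (a : Bool) (p : Subset n) (b : Bool) (q : Subset n) →
  disjointᵇ (a Vec.∷ p) (b Vec.∷ q) ≡ (not (a ∧ b) ∧ disjointᵇ p q)
disjointᵇ-cons {n} a p b q =
  trans (allFinᵇ-suc (λ i → not (i ∈ᵇ (a Vec.∷ p) ∧ i ∈ᵇ (b Vec.∷ q))))
  (cong₂ _∧_ (cong₂ (λ x y → not (x ∧ y)) (∈ᵇ-lookup zero (a Vec.∷ p)) (∈ᵇ-lookup zero (b Vec.∷ q)))
             (cong (foldr _∧_ true) (map-cong (λ i → cong₂ (λ x y → not (x ∧ y)) (∈ᵇ-suc i a p) (∈ᵇ-suc i b q)) (allFin n))))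

⊆ᵇ-∖ : {n : ℕ} (p q σ : Subset n) → p ⊆ᵇ (σ ∖ q) ≡ (disjointᵇ p q ∧ p ⊆ᵇ σ)
⊆ᵇ-∖ Vec.[] Vec.[] Vec.[] = refl
⊆ᵇ-∖ (a Vec.∷ p) (b Vec.∷ q) (x Vec.∷ σ) rewrite disjointᵇ-cons a p b q with a | b | x
... | true | true | _ = refl
... | true | false | true = ⊆ᵇ-∖ p q σ
... | true | false | false = sym (∧-zeroʳ (disjointᵇ p q))
... | false | true | _ = ⊆ᵇ-∖ p q σ
... | false | false | _ = ⊆ᵇ-∖ p q σ

disjoint-from-all : {n k : ℕ} (p : Subset n) (τ : Vec (Subset n) k) →
  Vec.foldr (λ _ → Bool) (λ q b → disjointᵇ p q ∧ b) true τ ≡ p ⊆ᵇ complementUnion τ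
disjoint-from-all p Vec.[] = sym (⊆ᵇ-full p)
disjoint-from-all p (q Vec.∷ τ) =
  trans (cong (disjointᵇ p q ∧_) (disjoint-from-all p τ))
  (trans (sym (⊆ᵇ-∖ p q (complementUnion τ))) (cong (p ⊆ᵇ_) (sym (complementUnion-cons q τ))))

pairwiseDisjoint-cons : {n k : ℕ} (τ₁ : Subset n) (τ : Vec (Subset n) k) →
  pairwiseDisjointᵇ (τ₁ Vec.∷ τ) ≡ (τ₁ ⊆ᵇ complementUnion τ ∧ pairwiseDisjointᵇ τ)
pairwiseDisjoint-cons τ₁ τ = cong (_∧ pairwiseDisjointᵇ τ) (disjoint-from-all τ₁ τ)


withoutAll : {N k : ℕ} → (Fin N → Bool) → (Fin k → Fin N) → Fin N → Bool
withoutAll Q j d = Q d ∧ not (anyFin (λ t → ⌊ j t ≟ d ⌋))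

weights : {n N k : ℕ} → (Fin n → Fin N → ℤ) → (Fin k → Fin N) → Vec (Subset n) k → ℤ
weights {k = k} r j τ = ΠL (map (λ t → weight r (Vec.lookup τ t) (j t)) (allFin k))

tupleTerm : {n N k : ℕ} → (Fin n → Fin N → ℤ) → (Fin k → Fin N) → (Fin N → Bool) → Vec (Subset n) k → ℤ
tupleTerm r j Q τ = if pairwiseDisjointᵇ τ then weights r j τ * S-on (rowsOf r (complementUnion τ)) Q else 0ℤ

guard-∧ : (b p : Bool) (w P s : ℤ) → (if b ∧ p then w * P * s else 0ℤ) ≡ (if p then P * (if b then w * s else 0ℤ) else 0ℤ)
guard-∧ true true w P s = ring w P s
  where
  ring : ∀ w P s → w * P * s ≡ P * (w * s)
  ring = solve-∀
guard-∧ false true w P s = sym (*-zeroʳ P)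
guard-∧ true false w P s = refl
guard-∧ false false w P s = refl

tupleTerm-cons : {n N k : ℕ} (r : Fin n → Fin N → ℤ) (j : Fin (suc k) → Fin N) (Q : Fin N → Bool)
  (τ₁ : Subset n) (τ : Vec (Subset n) k) →
  tupleTerm r j Q (τ₁ Vec.∷ τ)
    ≡ (if pairwiseDisjointᵇ τ
       then weights r (λ t → j (suc t)) τ
            * (if τ₁ ⊆ᵇ complementUnion τ then weight r τ₁ (j zero) * S-on (rowsOf r (complementUnion τ ∖ τ₁)) Q else 0ℤ)
       else 0ℤ)
tupleTerm-cons {k = k} r j Q τ₁ τ =
  trans (cong₂ (λ g z → if g then z else 0ℤ) (pairwiseDisjoint-cons τ₁ τ)
          (cong₂ (λ w rows → w * S-on rows Q)
            (productOver-allFin-suc k (λ t → weight r (Vec.lookup (τ₁ Vec.∷ τ) t) (j t)))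
            (cong (rowsOf r) (complementUnion-cons τ₁ τ))))
  (guard-∧ (τ₁ ⊆ᵇ complementUnion τ) (pairwiseDisjointᵇ τ) (weight r τ₁ (j zero)) (weights r (λ t → j (suc t)) τ) _)

sumOver-first-subset : {n N k : ℕ} (r : Fin n → Fin N → ℤ) (j : Fin (suc k) → Fin N) (Q : Fin N → Bool) →
  Q (j zero) ≡ true → (τ : Vec (Subset n) k) →
  sumOver (allSubsets n) (λ τ₁ → tupleTerm r j Q (τ₁ Vec.∷ τ)) ≡ tupleTerm r (λ t → j (suc t)) (Q without j zero) τ
sumOver-first-subset {n} r j Q j₁∈Q τ =
  trans (sumOver-cong (allSubsets n) (λ τ₁ → tupleTerm-cons r j Q τ₁ τ))
  (trans (sumOver-if (allSubsets n) (pairwiseDisjointᵇ τ) _)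
  (cong (λ z → if pairwiseDisjointᵇ τ then z else 0ℤ)
    (trans (sumOver-*ˡ (allSubsets n) (weights r (λ t → j (suc t)) τ) _)
           (cong (weights r (λ t → j (suc t)) τ *_) (delete-column r (complementUnion τ) Q (j zero) j₁∈Q)))))

delete-columns : {n N : ℕ} (r : Fin n → Fin N → ℤ) (k : ℕ) (j : Fin k → Fin N) → Injective _≡_ _≡_ j →
  (Q : Fin N → Bool) → (∀ t → Q (j t) ≡ true) →
  sumOver (allVecs (allSubsets n) k) (tupleTerm r j Q) ≡ S-on (map r (allFin n)) (withoutAll Q j)
delete-columns {n} r zero j j-inj Q j∈Q =
  trans (+-identityʳ _) (trans (*-identityˡ _)
  (trans (cong (λ rows → S-on (map r rows) Q) (members-all n)) (S-on-cong (map r (allFin n)) (λ d → sym (∧-identityʳ (Q d))))))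
delete-columns {n} {N} r (suc k) j j-inj Q j∈Q =
  trans (sumOver-allVecs (allSubsets n) k (tupleTerm r j Q))
  (trans (sumOver-cong (allVecs (allSubsets n) k) (sumOver-first-subset r j Q (j∈Q zero)))
  (trans (delete-columns r k j′ (λ eq → suc-injective (j-inj eq)) (Q without j zero) j′∈Q′)
  (S-on-cong (map r (allFin n)) same-columns)))
  where
  j′ : Fin k → Fin N
  j′ t = j (suc t)
  j′∈Q′ : ∀ t → (Q without j zero) (j′ t) ≡ true
  j′∈Q′ t = trans (without-other Q (λ eq → 0≢suc (j-inj eq))) (j∈Q (suc t))
    where
    0≢suc : ¬ (zero ≡ suc t)
    0≢suc ()
  same-columns : ∀ d → withoutAll (Q without j zero) j′ d ≡ withoutAll Q j d
  same-columns d = trans (regroup (Q d) ⌊ j zero ≟ d ⌋ _) (cong (λ b → Q d ∧ not b) (sym (anyFin-suc (λ t → ⌊ j t ≟ d ⌋))))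
    where
    regroup : ∀ a b c → ((a ∧ not b) ∧ not c) ≡ (a ∧ not (b ∨ c))
    regroup true true c = refl
    regroup true false c = refl
    regroup false b c = refl


if-true-false : (b : Bool) → (if b then true else false) ≡ b
if-true-false true = refl
if-true-false false = refl

S[]-all-columns : {n N : ℕ} (r : Fin n → Fin N → ℤ) (σ : Subset n) → S[ r ] σ ≡ S-on (rowsOf r σ) (λ _ → true)
S[]-all-columns {N = N} r σ =
  trans (cong (λ cs → S (subMatrix r (members σ) cs)) (sym (filter-true (allFin N)))) (S-subMatrix r (members σ) (λ _ → true))

S^-expansion : (n N k : ℕ) (r : Fin n → Fin N → ℤ) (j : Fin k → Fin N) → Injective _≡_ _≡_ j → S^ (imageSet j) r ≡ RHS r j
S^-expansion n N k r j j-inj =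
  begin
    S^ (imageSet j) r
  ≡⟨ S-subMatrix r (allFin n) (λ d → not (d ∈ᵇ imageSet j)) ⟩
    S-on (map r (allFin n)) (λ d → not (d ∈ᵇ imageSet j))
  ≡⟨ S-on-cong (map r (allFin n)) outside-image ⟩
    S-on (map r (allFin n)) (withoutAll (λ _ → true) j)
  ≡⟨ delete-columns r k j j-inj (λ _ → true) (λ _ → refl) ⟨
    sumOver (allVecs (allSubsets n) k) (tupleTerm r j (λ _ → true))
  ≡⟨ sumOver-cong (allVecs (allSubsets n) k) all-columns ⟨
    sumOver (allVecs (allSubsets n) k) (λ τ → if pairwiseDisjointᵇ τ then weights r j τ * S[ r ] (complementUnion τ) else 0ℤ)
  ≡⟨ sumOver-filter (allVecs (allSubsets n) k) pairwiseDisjointᵇ _ ⟨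
    RHS r j
  ∎
  where
  open ≡-Reasoning
  outside-image : ∀ d → not (d ∈ᵇ imageSet j) ≡ withoutAll (λ _ → true) j d
  outside-image d = cong not (trans (∈ᵇ-lookup d (imageSet j)) (trans (lookup∘tabulate _ d) (if-true-false _)))
  all-columns : ∀ τ → (if pairwiseDisjointᵇ τ then weights r j τ * S[ r ] (complementUnion τ) else 0ℤ) ≡ tupleTerm r j (λ _ → true) τ
  all-columns τ = cong (λ z → if pairwiseDisjointᵇ τ then weights r j τ * z else 0ℤ) (S[]-all-columns r (complementUnion τ))

≡-mod-refl : (p : ℕ) (a : ℤ) → a ≡ a [modℤ p ]
≡-mod-refl p a rewrite +-inverseʳ a = p ∣0

proposition2p7 : (p : ℕ) → Prime p → (n N k : ℕ) (r : Fin n → Fin N → ℤ)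
                 (j : Fin k → Fin N) → Injective _≡_ _≡_ j →
                 S^ (imageSet j) r ≡ RHS r j [modℤ p ]
proposition2p7 p _ n N k r j j-inj rewrite S^-expansion n N k r j j-inj = ≡-mod-refl p (RHS r j)
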